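{- Let $\Delta$ be a non-empty lattice polygon and let \[ S_{1,1}(\Delta) = \{ (a,b) \in \mathbb{N}^2 \mid a \le b \text{ and there is a lattice polygon } \Delta' \simeq \Delta \text{ with } \Delta' \subset [0,a]\times[0,b] \}. \] Then $S_{1,1}(\Delta)$ has a minimum with respect to the product order on $\mathbb{N}^2$ (where $(a,b) \le (a',b')$ iff $a \le a'$ and $b \le b'$). This minimum is $(\mathrm{lw}(\Delta), \mathrm{ls}_\square(\Delta))$.
   Context: $\mathbb{N} = \{0,1,2,\dots\}$. A lattice polygon is the convex hull of finitely many points of $\mathbb{Z}^2$; it may be empty, a point or a segment. A unimodular transformation is an affine map $\mathbb{R}^2 \to \mathbb{R}^2$, $v \mapsto Av + w$, with $A \in \mathrm{GL}_2(\mathbb{Z})$ and $w \in \mathbb{Z}^2$. For lattice polygons, $\Delta \simeq \Delta'$ means $\Delta' = \varphi(\Delta)$ for some unimodular transformation $\varphi$. Let $\square = [0,1]^2$. For a non-empty lattice polygon $\Delta$: - the lattice size $\mathrm{ls}_\square(\Delta)$ is the smallest integer $d \ge 0$ such that $\varphi(\Delta) \subset d\square$ for some unimodular $\varphi$; - the lattice width $\mathrm{lw}(\Delta)$ is the smallest integer $d \ge 0$ such that $\varphi(\Delta) \subset [0,d] \times \mathbb{R}$ for some unimodular $\varphi$.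
   Formalization: Points of Δ are taken as rational convex combinations of its lattice points, so containment of unimodular images in the boxes [0,a]×[0,b] and in strips is tested on points of ℚ² rather than ℝ². -}

module Defs where

open import Data.Nat using (ℕ; suc) renaming (_≤_ to _≤ℕ_)
open import Data.Integer as ℤ using (ℤ; +_; -[1+_])
open import Data.Rational using (ℚ; 0ℚ; 1ℚ; _/_; _+_; _*_; _≤_)
open import Data.Fin using (Fin; zero; suc)
open import Data.Vec using (Vec; lookup)
open import Data.Product using (_×_; _,_; ∃; Σ; proj₁; proj₂)
open import Data.Sum using (_⊎_)
open import Relation.Binary.PropositionalEquality using (_≡_)

-- points of ℤ² and of ℚ² (ℚ² stands in for ℝ²; all relevant maps/points are rational)
Point : Set
Point = ℤ × ℤ

Pointℚ : Set
Pointℚ = ℚ × ℚ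

ι : ℤ → ℚ
ι k = k / 1

ιℕ : ℕ → ℚ
ιℕ k = (+ k) / 1

sumFin : ∀ {n} → (Fin n → ℚ) → ℚ
sumFin {ℕ.zero} f = 0ℚ
sumFin {suc n} f = f zero + sumFin (λ i → f (suc i))

-- A non-empty lattice polygon is given as conv(P) for a non-empty finite list
-- P of lattice points.  Membership of a (rational) point in conv(P):
InConv : ∀ {n} → Vec Point (suc n) → Pointℚ → Set
InConv {n} P (x , y) =
  ∃ λ (w : Fin (suc n) → ℚ) →
    (∀ i → 0ℚ ≤ w i) ×
    sumFin w ≡ 1ℚ ×
    sumFin (λ i → w i * ι (proj₁ (lookup P i))) ≡ x ×
    sumFin (λ i → w i * ι (proj₂ (lookup P i))) ≡ y

record Unimodular : Set where
  field
    a b c d e f : ℤ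
    det±1 : (a ℤ.* d ℤ.- b ℤ.* c ≡ + 1) ⊎ (a ℤ.* d ℤ.- b ℤ.* c ≡ -[1+ 0 ])

apply : Unimodular → Pointℚ → Pointℚ
apply φ (x , y) =
  (ι a * x + ι b * y + ι e) , (ι c * x + ι d * y + ι f)
  where open Unimodular φ

ImageIn : ∀ {n} → Unimodular → Vec Point (suc n) → (Pointℚ → Set) → Set
ImageIn φ P X = ∀ v → InConv P v → X (apply φ v)

Box : ℕ → ℕ → Pointℚ → Set
Box a b (x , y) = (0ℚ ≤ x × x ≤ ιℕ a) × (0ℚ ≤ y × y ≤ ιℕ b)

Strip : ℕ → Pointℚ → Set
Strip d (x , y) = 0ℚ ≤ x × x ≤ ιℕ d

InS11 : ∀ {n} → Vec Point (suc n) → ℕ × ℕ → Set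
InS11 P (a , b) = a ≤ℕ b × ∃ λ φ → ImageIn φ P (Box a b)

IsLeast : (ℕ → Set) → ℕ → Set
IsLeast Q d = Q d × (∀ d' → Q d' → d ≤ℕ d')

IsLatticeSize : ∀ {n} → Vec Point (suc n) → ℕ → Set
IsLatticeSize P = IsLeast (λ d → ∃ λ φ → ImageIn φ P (Box d d))

IsLatticeWidth : ∀ {n} → Vec Point (suc n) → ℕ → Set
IsLatticeWidth P = IsLeast (λ d → ∃ λ φ → ImageIn φ P (Strip d))

_≤ₚ_ : ℕ × ℕ → ℕ × ℕ → Set
(a , b) ≤ₚ (a' , b') = a ≤ℕ a' × b ≤ℕ b'

-- The lattice width and the lattice size of Δ = conv(P) are the two successive
-- minima of a single seminorm on ℤ², the width functional
--   ‖u‖ = max_{p ∈ P} ⟨u , p⟩ - min_{p ∈ P} ⟨u , p⟩ .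
-- A unimodular map with linear rows u , w places Δ (after translation) in
-- [0 , A] × [0 , C] exactly when ‖u‖ ≤ A and ‖w‖ ≤ C; rows of a unimodular map
-- form a basis of ℤ², and conversely.  Lagrange–Gauss reduction, valid for any
-- ℕ-valued seminorm on ℤ², yields a basis (b₁ , b₂) with ‖b₁‖ ≤ ‖b₂‖ such that
-- ‖b₁‖ ≤ ‖v‖ for every v ≠ 0 and ‖b₂‖ ≤ max (‖u‖ , ‖w‖) for every basis (u , w).
-- Hence (‖b₁‖ , ‖b₂‖) lies in S₁₁(Δ), lies below every element of it, and equals
-- (lw Δ , ls Δ).

module Submission where

open import Defs
open import Data.Empty using (⊥-elim)
open import Data.Fin using (Fin; zero; suc)
open import Function using (_∘_)
open import Data.Integer as ℤ using (ℤ; +_; -[1+_]; ∣_∣; _+_; _*_; -_; _-_; _≤_; 0ℤ; 1ℤ; -1ℤ)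
import Data.Integer.Properties as ℤP
open import Data.Integer.DivMod using (_/ℕ_; _%ℕ_; a≡a%ℕn+[a/ℕn]*n; n%ℕd<d)
open import Data.Integer.Tactic.RingSolver using (solve-∀)
open import Data.Nat as ℕ using (ℕ; suc; zero; _⊔_)
import Data.Nat.Coprimality as Coprimality
import Data.Nat.Properties as ℕP
open import Data.Product using (_×_; _,_; ∃; Σ; proj₁; proj₂; uncurry)
open import Data.Rational as ℚ using (ℚ; mkℚ; 0ℚ; 1ℚ; *≤*)
import Data.Rational.Properties as ℚP
open import Data.Rational.Solver using (module +-*-Solver)
open import Data.Sum using (_⊎_; inj₁; inj₂)
open import Data.Vec using (Vec; lookup; _∷_; [])
open import Relation.Binary.PropositionalEquality
open import Relation.Nullary using (¬_; yes; no)

infixl 6 _⊕_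
infixr 7 _·_

_⊕_ : Point → Point → Point
(a , b) ⊕ (c , d) = (a + c , b + d)

_·_ : ℤ → Point → Point
k · (a , b) = (k * a , k * b)

neg : Point → Point
neg v = -1ℤ · v

0ᵥ : Point
0ᵥ = (0ℤ , 0ℤ)

⊕-identityʳ : ∀ v → v ⊕ 0ᵥ ≡ v
⊕-identityʳ (x , y) = cong₂ _,_ (ℤP.+-identityʳ x) (ℤP.+-identityʳ y)

dot : Point → Point → ℤ
dot (a , b) (x , y) = a * x + b * y

det : Point → Point → ℤ
det (a , b) (c , d) = a * d - b * c

dot-⊕ : ∀ u v p → dot (u ⊕ v) p ≡ dot u p + dot v p
dot-⊕ (a , b) (c , d) (x , y) = identity a b c d x y
  where
  identity : ∀ a b c d x y → (a + c) * x + (b + d) * y ≡ (a * x + b * y) + (c * x + d * y)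
  identity = solve-∀

dot-· : ∀ k v p → dot (k · v) p ≡ k * dot v p
dot-· k (a , b) (x , y) = identity k a b x y
  where
  identity : ∀ k a b x y → k * a * x + k * b * y ≡ k * (a * x + b * y)
  identity = solve-∀

dot-neg : ∀ u p → dot (neg u) p ≡ - dot u p
dot-neg u p = trans (dot-· -1ℤ u p) (ℤP.-1*i≡-i (dot u p))

·-comm : ∀ k l v → k · l · v ≡ l · k · v
·-comm k l (a , b) = cong₂ _,_ (identity k l a) (identity k l b)
  where
  identity : ∀ k l a → k * (l * a) ≡ l * (k * a)
  identity = solve-∀

neg-involutive : ∀ v → neg (neg v) ≡ v
neg-involutive (a , b) = cong₂ _,_ (identity a) (identity b)
  where
  identity : ∀ a → -1ℤ * (-1ℤ * a) ≡ a
  identity = solve-∀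

neg-⊕ : ∀ u v → neg (u ⊕ v) ≡ neg u ⊕ neg v
neg-⊕ (a , b) (c , d) = cong₂ _,_ (identity a c) (identity b d)
  where
  identity : ∀ a c → -1ℤ * (a + c) ≡ -1ℤ * a + -1ℤ * c
  identity = solve-∀

negative-· : ∀ m v → -[1+ m ] · v ≡ + suc m · neg v
negative-· m (a , b) = cong₂ _,_ (identity (+ suc m) a) (identity (+ suc m) b)
  where
  identity : ∀ k a → - k * a ≡ k * (-1ℤ * a)
  identity = solve-∀

shear-scaled : ∀ k b c → + suc k · (b ⊕ c) ≡ + k · b ⊕ (b ⊕ + suc k · c)
shear-scaled k (x , y) (a , b) = cong₂ _,_ (identity (+ k) x a) (identity (+ k) y b)
  where
  identity : ∀ k x a → (1ℤ + k) * (x + a) ≡ k * x + (x + (1ℤ + k) * a)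
  identity = solve-∀

Unit : ℤ → Set
Unit x = (x ≡ 1ℤ) ⊎ (x ≡ -1ℤ)

Basis : Point → Point → Set
Basis u w = Unit (det u w)

unit-square : ∀ {x} → Unit x → x * x ≡ 1ℤ
unit-square (inj₁ refl) = refl
unit-square (inj₂ refl) = refl

zero-not-unit : ¬ Unit 0ℤ
zero-not-unit (inj₁ ())
zero-not-unit (inj₂ ())

basis-nonzero : ∀ {u w} → Basis u w → u ≢ 0ᵥ
basis-nonzero (inj₁ ()) refl
basis-nonzero (inj₂ ()) refl

det-antisym : ∀ u w → det w u ≡ - det u w
det-antisym (a , b) (c , d) = identity a b c d
  where
  identity : ∀ a b c d → c * b - d * a ≡ - (a * d - b * c)
  identity = solve-∀

basis-swap : ∀ u w → Basis u w → Basis w u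
basis-swap u w (inj₁ e) = inj₂ (trans (det-antisym u w) (cong -_ e))
basis-swap u w (inj₂ e) = inj₁ (trans (det-antisym u w) (cong -_ e))

det-shear⁺ : ∀ u w → det u (w ⊕ u) ≡ det u w
det-shear⁺ (a , b) (c , d) = identity a b c d
  where
  identity : ∀ a b c d → a * (d + b) - b * (c + a) ≡ a * d - b * c
  identity = solve-∀

det-shear⁻ : ∀ u w → det u (w ⊕ neg u) ≡ det u w
det-shear⁻ (a , b) (c , d) = identity a b c d
  where
  identity : ∀ a b c d → a * (d + -1ℤ * b) - b * (c + -1ℤ * a) ≡ a * d - b * c
  identity = solve-∀

det-parallel : ∀ s t p → det (s · p) (t · p) ≡ 0ℤ
det-parallel s t (a , b) = identity s t a b
  where
  identity : ∀ s t a b → s * a * (t * b) - s * b * (t * a) ≡ 0ℤ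
  identity = solve-∀

-- Cramer's rule: the coordinates of v in a basis (u , w) are
-- D · det(v , w) and D · det(u , v), where D = det(u , w) = D⁻¹.
coordinates : ∀ u w → Basis u w → ∀ v →
  v ≡ (det u w * det v w) · u ⊕ (det u w * det u v) · w
coordinates (a , b) (c , d) B (x , y) =
  sym (cong₂ _,_ (trans (expand₁ a b c d x y) (cancel x)) (trans (expand₂ a b c d x y) (cancel y)))
  where
  cancel : ∀ z → (a * d - b * c) * (a * d - b * c) * z ≡ z
  cancel z = trans (cong (_* z) (unit-square B)) (ℤP.*-identityˡ z)
  expand₁ : ∀ a b c d x y → (a * d - b * c) * (x * d - y * c) * a + (a * d - b * c) * (a * y - b * x) * c
                            ≡ (a * d - b * c) * (a * d - b * c) * x
  expand₁ = solve-∀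
  expand₂ : ∀ a b c d x y → (a * d - b * c) * (x * d - y * c) * b + (a * d - b * c) * (a * y - b * x) * d
                            ≡ (a * d - b * c) * (a * d - b * c) * y
  expand₂ = solve-∀

record Seminorm : Set where
  field
    ‖_‖ : Point → ℕ
    triangle : ∀ u v → ‖ u ⊕ v ‖ ℕ.≤ ‖ u ‖ ℕ.+ ‖ v ‖
    homogeneous : ∀ k v → ‖ k · v ‖ ≡ ∣ k ∣ ℕ.* ‖ v ‖

module Reduction (N : Seminorm) where
  open Seminorm N

  ‖neg‖ : ∀ v → ‖ neg v ‖ ≡ ‖ v ‖
  ‖neg‖ v = trans (homogeneous -1ℤ v) (ℕP.*-identityˡ ‖ v ‖)

  Reduced : Point → Point → Set
  Reduced b₁ b₂ = ‖ b₁ ‖ ℕ.≤ ‖ b₂ ‖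
                × ‖ b₂ ‖ ℕ.≤ ‖ b₂ ⊕ b₁ ‖
                × ‖ b₂ ‖ ℕ.≤ ‖ b₂ ⊕ neg b₁ ‖

  -- Convexity: if b is not shortened by one step in direction c,
  -- it is not shortened by any number of steps.
  no-shortening : ∀ b c → ‖ b ‖ ℕ.≤ ‖ b ⊕ c ‖ → ∀ m → ‖ b ‖ ℕ.≤ ‖ b ⊕ + m · c ‖
  no-shortening b c h zero = ℕP.≤-reflexive (cong ‖_‖ (sym (⊕-identityʳ b)))
  no-shortening b c h (suc k) = ℕP.+-cancelˡ-≤ (k ℕ.* ‖ b ‖) ‖ b ‖ ‖ b ⊕ + suc k · c ‖ (begin
    k ℕ.* ‖ b ‖ ℕ.+ ‖ b ‖                   ≡⟨ ℕP.+-comm (k ℕ.* ‖ b ‖) ‖ b ‖ ⟩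
    suc k ℕ.* ‖ b ‖                         ≤⟨ ℕP.*-monoʳ-≤ (suc k) h ⟩
    suc k ℕ.* ‖ b ⊕ c ‖                     ≡⟨ homogeneous (+ suc k) (b ⊕ c) ⟨
    ‖ + suc k · (b ⊕ c) ‖                   ≡⟨ cong ‖_‖ (shear-scaled k b c) ⟩
    ‖ + k · b ⊕ (b ⊕ + suc k · c) ‖         ≤⟨ triangle (+ k · b) (b ⊕ + suc k · c) ⟩
    ‖ + k · b ‖ ℕ.+ ‖ b ⊕ + suc k · c ‖     ≡⟨ cong (ℕ._+ ‖ b ⊕ + suc k · c ‖) (homogeneous (+ k) b) ⟩
    k ℕ.* ‖ b ‖ ℕ.+ ‖ b ⊕ + suc k · c ‖     ∎)
    where open ℕP.≤-Reasoning

  reduced-all : ∀ {b₁ b₂} → Reduced b₁ b₂ → ∀ k → ‖ b₂ ‖ ℕ.≤ ‖ b₂ ⊕ k · b₁ ‖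
  reduced-all {b₁} {b₂} (_ , plus , _) (+ m) = no-shortening b₂ b₁ plus m
  reduced-all {b₁} {b₂} (_ , _ , minus) -[1+ m ] =
    subst (λ z → ‖ b₂ ‖ ℕ.≤ ‖ b₂ ⊕ z ‖) (sym (negative-· m b₁)) (no-shortening b₂ (neg b₁) minus (suc m))

  ReducedBasis : Set
  ReducedBasis = Σ Point λ b₁ → Σ Point λ b₂ → Basis b₁ b₂ × Reduced b₁ b₂

  fuel-decreases : ∀ {b₁ b₂ c fuel} → ‖ c ‖ ℕ.< ‖ b₂ ‖ →
                   ‖ b₁ ‖ ℕ.+ ‖ b₂ ‖ ℕ.< suc fuel → ‖ b₁ ‖ ℕ.+ ‖ c ‖ ℕ.< fuel
  fuel-decreases {b₁} c<b₂ h = ℕP.<-≤-trans (ℕP.+-monoʳ-< ‖ b₁ ‖ c<b₂) (ℕP.≤-pred h)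

  -- Each round
  -- decreases ‖b₁‖ + ‖b₂‖, which is bounded by the fuel.
  mutual
    order : ∀ fuel b₁ c → Basis b₁ c → ‖ b₁ ‖ ℕ.+ ‖ c ‖ ℕ.< fuel → ReducedBasis
    order fuel b₁ c B h with ‖ c ‖ ℕP.<? ‖ b₁ ‖
    ... | yes c<b₁ = reduce fuel c b₁ (basis-swap b₁ c B) (ℕP.<⇒≤ c<b₁)
                            (subst (ℕ._< fuel) (ℕP.+-comm ‖ b₁ ‖ ‖ c ‖) h)
    ... | no c≮b₁ = reduce fuel b₁ c B (ℕP.≮⇒≥ c≮b₁) h

    reduce : ∀ fuel b₁ b₂ → Basis b₁ b₂ → ‖ b₁ ‖ ℕ.≤ ‖ b₂ ‖ →
             ‖ b₁ ‖ ℕ.+ ‖ b₂ ‖ ℕ.< fuel → ReducedBasis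
    reduce (suc fuel) b₁ b₂ B b₁≤b₂ h with ‖ b₂ ⊕ b₁ ‖ ℕP.<? ‖ b₂ ‖
    ... | yes shorter =
      order fuel b₁ (b₂ ⊕ b₁) (subst Unit (sym (det-shear⁺ b₁ b₂)) B) (fuel-decreases shorter h)
    ... | no plus with ‖ b₂ ⊕ neg b₁ ‖ ℕP.<? ‖ b₂ ‖
    ... | yes shorter =
      order fuel b₁ (b₂ ⊕ neg b₁) (subst Unit (sym (det-shear⁻ b₁ b₂)) B) (fuel-decreases shorter h)
    ... | no minus = b₁ , b₂ , B , b₁≤b₂ , ℕP.≮⇒≥ plus , ℕP.≮⇒≥ minus

  reduced-basis : ReducedBasis
  reduced-basis = order (suc (‖ e₁ ‖ ℕ.+ ‖ e₂ ‖)) e₁ e₂ (inj₁ refl) (ℕP.n<1+n _)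
    where
    e₁ e₂ : Point
    e₁ = (1ℤ , 0ℤ)
    e₂ = (0ℤ , 1ℤ)

  module Minima {b₁ b₂ : Point} (B : Basis b₁ b₂) (R : Reduced b₁ b₂) where

    D : ℤ
    D = det b₁ b₂

    D-involutive : ∀ t → D * (D * t) ≡ t
    D-involutive t = trans (sym (ℤP.*-assoc D D t)) (trans (cong (_* t) (unit-square B)) (ℤP.*-identityˡ t))

    -- A vector with positive b₂-coordinate Y is no shorter than b₂: writing its
    -- b₁-coordinate as r + qY with 0 ≤ r < Y, reducedness gives
    -- Y ‖b₂‖ ≤ Y ‖b₂ + q b₁‖ ≤ ‖v‖ + r ‖b₁‖ ≤ ‖v‖ + r ‖b₂‖.
    above-line : ∀ x m v → v ≡ x · b₁ ⊕ + suc m · b₂ → ‖ b₂ ‖ ℕ.≤ ‖ v ‖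
    above-line x m v refl = ℕP.+-cancelʳ-≤ (r ℕ.* ‖ b₂ ‖) ‖ b₂ ‖ ‖ v ‖ (begin
      ‖ b₂ ‖ ℕ.+ r ℕ.* ‖ b₂ ‖                ≤⟨ ℕP.+-monoʳ-≤ ‖ b₂ ‖ (ℕP.*-monoˡ-≤ ‖ b₂ ‖ r≤m) ⟩
      suc m ℕ.* ‖ b₂ ‖                       ≤⟨ ℕP.*-monoʳ-≤ (suc m) (reduced-all R q) ⟩
      suc m ℕ.* ‖ b₂ ⊕ q · b₁ ‖              ≡⟨ homogeneous (+ suc m) (b₂ ⊕ q · b₁) ⟨
      ‖ + suc m · (b₂ ⊕ q · b₁) ‖            ≡⟨ cong ‖_‖ regroup ⟩
      ‖ v ⊕ - + r · b₁ ‖                     ≤⟨ triangle v (- + r · b₁) ⟩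
      ‖ v ‖ ℕ.+ ‖ - + r · b₁ ‖               ≡⟨ cong (‖ v ‖ ℕ.+_) ‖-r·b₁‖ ⟩
      ‖ v ‖ ℕ.+ r ℕ.* ‖ b₁ ‖                 ≤⟨ ℕP.+-monoʳ-≤ ‖ v ‖ (ℕP.*-monoʳ-≤ r (proj₁ R)) ⟩
      ‖ v ‖ ℕ.+ r ℕ.* ‖ b₂ ‖                 ∎)
      where
      open ℕP.≤-Reasoning
      q : ℤ
      q = x /ℕ suc m
      r : ℕ
      r = x %ℕ suc m
      x≡r+qY : x ≡ + r + q * + suc m
      x≡r+qY = a≡a%ℕn+[a/ℕn]*n x (suc m)
      r≤m : r ℕ.≤ m
      r≤m = ℕP.≤-pred (n%ℕd<d x (suc m))
      ‖-r·b₁‖ : ‖ - + r · b₁ ‖ ≡ r ℕ.* ‖ b₁ ‖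
      ‖-r·b₁‖ = trans (homogeneous (- + r) b₁) (cong (ℕ._* ‖ b₁ ‖) (ℤP.∣-i∣≡∣i∣ (+ r)))
      regroup : + suc m · (b₂ ⊕ q · b₁) ≡ x · b₁ ⊕ + suc m · b₂ ⊕ - + r · b₁
      regroup = trans (componentwise b₁ b₂) (cong (λ z → z · b₁ ⊕ + suc m · b₂ ⊕ - + r · b₁) (sym x≡r+qY))
        where
        componentwise : ∀ b₁ b₂ →
          + suc m · (b₂ ⊕ q · b₁) ≡ (+ r + q * + suc m) · b₁ ⊕ + suc m · b₂ ⊕ - + r · b₁
        componentwise (a , b) (c , d) =
          cong₂ _,_ (identity (+ suc m) q (+ r) a c) (identity (+ suc m) q (+ r) b d)
          where
          identity : ∀ Y q r a c → Y * (c + q * a) ≡ (r + q * Y) * a + Y * c + - r * a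
          identity = solve-∀

    on-line : ∀ v → det b₁ v ≡ 0ℤ → v ≡ (D * det v b₂) · b₁
    on-line v on = begin
      v                                          ≡⟨ coordinates b₁ b₂ B v ⟩
      (D * det v b₂) · b₁ ⊕ (D * det b₁ v) · b₂  ≡⟨ cong (λ t → (D * det v b₂) · b₁ ⊕ t · b₂) D·0 ⟩
      (D * det v b₂) · b₁ ⊕ 0ᵥ                   ≡⟨ ⊕-identityʳ _ ⟩
      (D * det v b₂) · b₁                        ∎
      where
      open ≡-Reasoning
      D·0 : D * det b₁ v ≡ 0ℤ
      D·0 = trans (cong (D *_) on) (ℤP.*-zeroʳ D)

    -- Second minimum: vectors off the line ℤ b₁ are no shorter than b₂
    -- (a negative b₂-coordinate is made positive by v ↦ -v).
    second-minimum : ∀ v → det b₁ v ≢ 0ℤ → ‖ b₂ ‖ ℕ.≤ ‖ v ‖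
    second-minimum v off = by-coordinate (D * det b₁ v) refl
      where
      x : ℤ
      x = D * det v b₂
      expansion : ∀ {y} → D * det b₁ v ≡ y → v ≡ x · b₁ ⊕ y · b₂
      expansion refl = coordinates b₁ b₂ B v
      by-coordinate : ∀ y → D * det b₁ v ≡ y → ‖ b₂ ‖ ℕ.≤ ‖ v ‖
      by-coordinate (+ zero) y≡0 =
        ⊥-elim (off (trans (sym (D-involutive (det b₁ v))) (trans (cong (D *_) y≡0) (ℤP.*-zeroʳ D))))
      by-coordinate (+ suc m) y≡ = above-line x m v (expansion y≡)
      by-coordinate -[1+ m ] y≡ =
        ℕP.≤-trans (above-line (- x) m (neg v) (trans (cong neg (expansion y≡)) (flip x b₁ b₂)))
                   (ℕP.≤-reflexive (‖neg‖ v))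
        where
        flip : ∀ x u w → neg (x · u ⊕ -[1+ m ] · w) ≡ - x · u ⊕ + suc m · w
        flip x (a , b) (c , d) = cong₂ _,_ (identity x (+ suc m) a c) (identity x (+ suc m) b d)
          where
          identity : ∀ x Y a c → -1ℤ * (x * a + - Y * c) ≡ - x * a + Y * c
          identity = solve-∀

    first-minimum : ∀ v → v ≢ 0ᵥ → ‖ b₁ ‖ ℕ.≤ ‖ v ‖
    first-minimum v v≢0 with det b₁ v ℤP.≟ 0ℤ
    ... | no off = ℕP.≤-trans (proj₁ R) (second-minimum v off)
    ... | yes on = subst (‖ b₁ ‖ ℕ.≤_) (sym ‖v‖≡) (ℕP.m≤n*m ‖ b₁ ‖ ∣ x ∣ {{ℕ.≢-nonZero x≢0}})
      where
      x : ℤ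
      x = D * det v b₂
      ‖v‖≡ : ‖ v ‖ ≡ ∣ x ∣ ℕ.* ‖ b₁ ‖
      ‖v‖≡ = trans (cong ‖_‖ (on-line v on)) (homogeneous x b₁)
      x≢0 : ∣ x ∣ ≢ 0
      x≢0 e = v≢0 (trans (on-line v on) (cong (_· b₁) (ℤP.∣i∣≡0⇒i≡0 {x} e)))

    leaves-line : ∀ u w → Basis u w → det b₁ u ≢ 0ℤ ⊎ det b₁ w ≢ 0ℤ
    leaves-line u w B′ with det b₁ u ℤP.≟ 0ℤ | det b₁ w ℤP.≟ 0ℤ
    ... | no off | _ = inj₁ off
    ... | yes _ | no off = inj₂ off
    ... | yes on-u | yes on-w = ⊥-elim (zero-not-unit (subst Unit parallel B′))
      where
      parallel : det u w ≡ 0ℤ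
      parallel = trans (cong₂ det (on-line u on-u) (on-line w on-w))
                       (det-parallel (D * det u b₂) (D * det w b₂) b₁)

    second-minimum-of-basis : ∀ u w → Basis u w → ‖ b₂ ‖ ℕ.≤ ‖ u ‖ ⊔ ‖ w ‖
    second-minimum-of-basis u w B′ with leaves-line u w B′
    ... | inj₁ off = ℕP.≤-trans (second-minimum u off) (ℕP.m≤m⊔n ‖ u ‖ ‖ w ‖)
    ... | inj₂ off = ℕP.≤-trans (second-minimum w off) (ℕP.m≤n⊔m ‖ u ‖ ‖ w ‖)

module Width {n : ℕ} (P : Vec Point (suc n)) where

  support : ∀ {m} → Vec Point (suc m) → Point → ℤ
  support (p ∷ []) u = dot u p
  support (p ∷ q ∷ ps) u = dot u p ℤ.⊔ support (q ∷ ps) u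

  support-ub : ∀ {m} (Q : Vec Point (suc m)) u i → dot u (lookup Q i) ≤ support Q u
  support-ub (p ∷ []) u zero = ℤP.≤-refl
  support-ub (p ∷ q ∷ ps) u zero = ℤP.i≤i⊔j _ _
  support-ub (p ∷ q ∷ ps) u (suc i) = ℤP.≤-trans (support-ub (q ∷ ps) u i) (ℤP.i≤j⊔i _ _)

  support-attained : ∀ {m} (Q : Vec Point (suc m)) u → ∃ λ i → support Q u ≡ dot u (lookup Q i)
  support-attained (p ∷ []) u = zero , refl
  support-attained (p ∷ q ∷ ps) u with ℤP.⊔-sel (dot u p) (support (q ∷ ps) u)
  ... | inj₁ e = zero , e
  ... | inj₂ e with support-attained (q ∷ ps) u
  ... | i , e' = suc i , trans e e'

  M : Point → ℤ
  M = support P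

  support-⊕ : ∀ u v → M (u ⊕ v) ≤ M u + M v
  support-⊕ u v with support-attained P (u ⊕ v)
  ... | i , e = begin
    M (u ⊕ v)                              ≡⟨ trans e (dot-⊕ u v _) ⟩
    dot u (lookup P i) + dot v (lookup P i) ≤⟨ ℤP.+-mono-≤ (support-ub P u i) (support-ub P v i) ⟩
    M u + M v                              ∎
    where open ℤP.≤-Reasoning

  support-· : ∀ m u → M (+ m · u) ≡ + m * M u
  support-· m u = ℤP.≤-antisym upper lower
    where
    upper : M (+ m · u) ≤ + m * M u
    upper with support-attained P (+ m · u)
    ... | i , e = subst (_≤ + m * M u) (sym (trans e (dot-· (+ m) u _)))
                    (ℤP.*-monoˡ-≤-nonNeg (+ m) (support-ub P u i))
    lower : + m * M u ≤ M (+ m · u)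
    lower with support-attained P u
    ... | j , e = subst (_≤ M (+ m · u)) (trans (dot-· (+ m) u _) (cong (+ m *_) (sym e)))
                    (support-ub P (+ m · u) j)

  widthℤ : Point → ℤ
  widthℤ u = M u + M (neg u)

  widthℤ-nonneg : ∀ u → 0ℤ ≤ widthℤ u
  widthℤ-nonneg u = subst (_≤ widthℤ u) (ℤP.+-inverseʳ (dot u p))
    (ℤP.+-mono-≤ (support-ub P u zero) (subst (_≤ M (neg u)) (dot-neg u p) (support-ub P (neg u) zero)))
    where
    p : Point
    p = lookup P zero

  widthℤ-⊕ : ∀ u v → widthℤ (u ⊕ v) ≤ widthℤ u + widthℤ v
  widthℤ-⊕ u v = begin
    M (u ⊕ v) + M (neg (u ⊕ v))           ≡⟨ cong (λ z → M (u ⊕ v) + M z) (neg-⊕ u v) ⟩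
    M (u ⊕ v) + M (neg u ⊕ neg v)         ≤⟨ ℤP.+-mono-≤ (support-⊕ u v) (support-⊕ (neg u) (neg v)) ⟩
    (M u + M v) + (M (neg u) + M (neg v)) ≡⟨ interchange (M u) (M v) (M (neg u)) (M (neg v)) ⟩
    widthℤ u + widthℤ v                   ∎
    where
    open ℤP.≤-Reasoning
    interchange : ∀ a b c d → (a + b) + (c + d) ≡ (a + c) + (b + d)
    interchange = solve-∀

  widthℤ-neg : ∀ u → widthℤ (neg u) ≡ widthℤ u
  widthℤ-neg u = trans (cong (λ z → M (neg u) + M z) (neg-involutive u)) (ℤP.+-comm (M (neg u)) (M u))

  widthℤ-+· : ∀ m u → widthℤ (+ m · u) ≡ + m * widthℤ u
  widthℤ-+· m u = begin
    M (+ m · u) + M (neg (+ m · u))     ≡⟨ cong (λ z → M (+ m · u) + M z) (·-comm -1ℤ (+ m) u) ⟩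
    M (+ m · u) + M (+ m · neg u)       ≡⟨ cong₂ _+_ (support-· m u) (support-· m (neg u)) ⟩
    + m * M u + + m * M (neg u)         ≡⟨ ℤP.*-distribˡ-+ (+ m) (M u) (M (neg u)) ⟨
    + m * widthℤ u                      ∎
    where open ≡-Reasoning

  widthℤ-· : ∀ k u → widthℤ (k · u) ≡ + ∣ k ∣ * widthℤ u
  widthℤ-· (+ m) u = widthℤ-+· m u
  widthℤ-· -[1+ m ] u = begin
    widthℤ (-[1+ m ] · u)          ≡⟨ cong widthℤ (negative-· m u) ⟩
    widthℤ (+ suc m · neg u)       ≡⟨ widthℤ-+· (suc m) (neg u) ⟩
    + suc m * widthℤ (neg u)       ≡⟨ cong (+ suc m *_) (widthℤ-neg u) ⟩
    + suc m * widthℤ u             ∎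
    where open ≡-Reasoning

  ‖_‖ : Point → ℕ
  ‖ u ‖ = ∣ widthℤ u ∣

  ‖‖≡widthℤ : ∀ u → + ‖ u ‖ ≡ widthℤ u
  ‖‖≡widthℤ u = ℤP.0≤i⇒+∣i∣≡i (widthℤ-nonneg u)

  value : Point → ℤ → Fin (suc n) → ℤ
  value u e i = dot u (lookup P i) + e

  InRange : ℕ → ℤ → Set
  InRange A z = 0ℤ ≤ z × z ≤ + A

  width-bound : ∀ u e A → (∀ i → InRange A (value u e i)) → ‖ u ‖ ℕ.≤ A
  width-bound u e A inRange with support-attained P u | support-attained P (neg u)
  ... | i , maxᵢ | j , maxⱼ = ℤP.drop‿+≤+ (begin
    + ‖ u ‖                                          ≡⟨ ‖‖≡widthℤ u ⟩
    M u + M (neg u)                                  ≡⟨ cong₂ _+_ maxᵢ (trans maxⱼ (dot-neg u (lookup P j))) ⟩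
    dot u (lookup P i) - dot u (lookup P j)          ≡⟨ shift (dot u (lookup P i)) (dot u (lookup P j)) e ⟩
    value u e i - value u e j                        ≤⟨ ℤP.+-mono-≤ (proj₂ (inRange i)) (ℤP.neg-mono-≤ (proj₁ (inRange j))) ⟩
    + A + 0ℤ                                         ≡⟨ ℤP.+-identityʳ (+ A) ⟩
    + A                                              ∎)
    where
    open ℤP.≤-Reasoning
    shift : ∀ p q e → p - q ≡ (p + e) - (q + e)
    shift = solve-∀

  -- ... and conversely a linear form of width ≤ A, shifted by its minimum on P,
  -- takes values in [0 , A] on P.
  centred-range : ∀ u A → ‖ u ‖ ℕ.≤ A → ∀ i → InRange A (value u (M (neg u)) i)
  centred-range u A ‖u‖≤A i = lower , upper
    where
    p : Point
    p = lookup P i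
    upper : dot u p + M (neg u) ≤ + A
    upper = ℤP.≤-trans (ℤP.+-monoˡ-≤ (M (neg u)) (support-ub P u i))
                       (subst (_≤ + A) (‖‖≡widthℤ u) (ℤ.+≤+ ‖u‖≤A))
    lower : 0ℤ ≤ dot u p + M (neg u)
    lower = subst (_≤ dot u p + M (neg u)) (ℤP.+-inverseʳ (dot u p))
      (ℤP.+-monoʳ-≤ (dot u p) (subst (_≤ M (neg u)) (dot-neg u p) (support-ub P (neg u) i)))

  width : Seminorm
  width = record
    { ‖_‖ = ‖_‖
    ; triangle = λ u v → ℤP.drop‿+≤+ (subst₂ _≤_ (sym (‖‖≡widthℤ (u ⊕ v)))
                   (sym (cong₂ _+_ (‖‖≡widthℤ u) (‖‖≡widthℤ v))) (widthℤ-⊕ u v))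
    ; homogeneous = λ k v → trans (cong ∣_∣ (widthℤ-· k v)) (ℤP.abs-* (+ ∣ k ∣) (widthℤ v))
    }

ι≡mkℚ : ∀ k → ι k ≡ mkℚ k 0 (Coprimality.sym (Coprimality.1-coprimeTo ∣ k ∣))
ι≡mkℚ k = ℚP.↥p/↧p≡p (mkℚ k 0 (Coprimality.sym (Coprimality.1-coprimeTo ∣ k ∣)))

ι-+ : ∀ k l → ι (k ℤ.+ l) ≡ ι k ℚ.+ ι l
ι-+ k l = trans (cong ι (cong₂ ℤ._+_ (sym (ℤP.*-identityʳ k)) (sym (ℤP.*-identityʳ l))))
                (sym (cong₂ ℚ._+_ (ι≡mkℚ k) (ι≡mkℚ l)))

ι-* : ∀ k l → ι (k ℤ.* l) ≡ ι k ℚ.* ι l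
ι-* k l = sym (cong₂ ℚ._*_ (ι≡mkℚ k) (ι≡mkℚ l))

ι-mono : ∀ {k l} → k ℤ.≤ l → ι k ℚ.≤ ι l
ι-mono {k} {l} k≤l = subst₂ ℚ._≤_ (sym (ι≡mkℚ k)) (sym (ι≡mkℚ l))
  (*≤* (subst₂ ℤ._≤_ (sym (ℤP.*-identityʳ k)) (sym (ℤP.*-identityʳ l)) k≤l))

ι-cancel : ∀ {k l} → ι k ℚ.≤ ι l → k ℤ.≤ l
ι-cancel {k} {l} ιk≤ιl with subst₂ ℚ._≤_ (ι≡mkℚ k) (ι≡mkℚ l) ιk≤ιl
... | *≤* k≤l = subst₂ ℤ._≤_ (ℤP.*-identityʳ k) (ℤP.*-identityʳ l) k≤l

sum-cong : ∀ {m} (f g : Fin m → ℚ) → (∀ i → f i ≡ g i) → sumFin f ≡ sumFin g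
sum-cong {zero} f g f≗g = refl
sum-cong {suc m} f g f≗g = cong₂ ℚ._+_ (f≗g zero) (sum-cong (f ∘ suc) (g ∘ suc) (f≗g ∘ suc))

sum-mono : ∀ {m} (f g : Fin m → ℚ) → (∀ i → f i ℚ.≤ g i) → sumFin f ℚ.≤ sumFin g
sum-mono {zero} f g f≤g = ℚP.≤-refl
sum-mono {suc m} f g f≤g = ℚP.+-mono-≤ (f≤g zero) (sum-mono (f ∘ suc) (g ∘ suc) (f≤g ∘ suc))

sum-*ʳ : ∀ {m} (w : Fin m → ℚ) c → sumFin (λ i → w i ℚ.* c) ≡ sumFin w ℚ.* c
sum-*ʳ {zero} w c = sym (ℚP.*-zeroˡ c)
sum-*ʳ {suc m} w c = trans (cong (λ s → w zero ℚ.* c ℚ.+ s) (sum-*ʳ (w ∘ suc) c))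
                           (sym (ℚP.*-distribʳ-+ c (w zero) (sumFin (w ∘ suc))))

sum-zero : ∀ {m} (g : Fin m → ℚ) → sumFin (λ j → 0ℚ ℚ.* g j) ≡ 0ℚ
sum-zero g = trans (sum-cong _ _ (λ j → ℚP.*-comm 0ℚ (g j))) (trans (sum-*ʳ g 0ℚ) (ℚP.*-zeroʳ (sumFin g)))

convex-bounds : ∀ {m} (w t : Fin m → ℚ) lo hi → (∀ i → 0ℚ ℚ.≤ w i) → sumFin w ≡ 1ℚ →
  (∀ i → lo ℚ.≤ t i × t i ℚ.≤ hi) →
  lo ℚ.≤ sumFin (λ i → w i ℚ.* t i) × sumFin (λ i → w i ℚ.* t i) ℚ.≤ hi
convex-bounds w t lo hi w≥0 Σw≡1 t∈ =
    subst (ℚ._≤ sumFin (λ i → w i ℚ.* t i)) (weighted lo) (sum-mono _ _ (λ i → scale i (proj₁ (t∈ i))))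
  , subst (sumFin (λ i → w i ℚ.* t i) ℚ.≤_) (weighted hi) (sum-mono _ _ (λ i → scale i (proj₂ (t∈ i))))
  where
  scale : ∀ i {x y} → x ℚ.≤ y → w i ℚ.* x ℚ.≤ w i ℚ.* y
  scale i = ℚP.*-monoˡ-≤-nonNeg (w i) {{ℚ.nonNegative (w≥0 i)}}
  weighted : ∀ c → sumFin (λ i → w i ℚ.* c) ≡ c
  weighted c = trans (sum-*ʳ w c) (trans (cong (ℚ._* c) Σw≡1) (ℚP.*-identityˡ c))

sum-affine : ∀ {m} (w x y : Fin m → ℚ) α β γ →
  α ℚ.* sumFin (λ i → w i ℚ.* x i) ℚ.+ β ℚ.* sumFin (λ i → w i ℚ.* y i) ℚ.+ γ ℚ.* sumFin w
    ≡ sumFin (λ i → w i ℚ.* (α ℚ.* x i ℚ.+ β ℚ.* y i ℚ.+ γ))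
sum-affine {zero} w x y α β γ = solve 3 (λ α β γ → α :* con 0ℚ :+ β :* con 0ℚ :+ γ :* con 0ℚ := con 0ℚ) refl α β γ
  where open +-*-Solver
sum-affine {suc m} w x y α β γ =
  trans (solve 9 (λ α β γ w₀ x₀ y₀ X Y W →
                   α :* (w₀ :* x₀ :+ X) :+ β :* (w₀ :* y₀ :+ Y) :+ γ :* (w₀ :+ W)
                   := w₀ :* (α :* x₀ :+ β :* y₀ :+ γ) :+ (α :* X :+ β :* Y :+ γ :* W))
                 refl α β γ (w zero) (x zero) (y zero) _ _ _)
        (cong (λ s → w zero ℚ.* (α ℚ.* x zero ℚ.+ β ℚ.* y zero ℚ.+ γ) ℚ.+ s)
              (sum-affine (w ∘ suc) (x ∘ suc) (y ∘ suc) α β γ))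
  where open +-*-Solver

point-mass : ∀ {m} → Fin m → Fin m → ℚ
point-mass zero zero = 1ℚ
point-mass zero (suc j) = 0ℚ
point-mass (suc i) zero = 0ℚ
point-mass (suc i) (suc j) = point-mass i j

point-mass-nonneg : ∀ {m} (i j : Fin m) → 0ℚ ℚ.≤ point-mass i j
point-mass-nonneg zero zero = ℚP.nonNegative⁻¹ 1ℚ
point-mass-nonneg zero (suc j) = ℚP.≤-refl
point-mass-nonneg (suc i) zero = ℚP.≤-refl
point-mass-nonneg (suc i) (suc j) = point-mass-nonneg i j

sum-point-mass : ∀ {m} (i : Fin m) (g : Fin m → ℚ) → sumFin (λ j → point-mass i j ℚ.* g j) ≡ g i
sum-point-mass zero g =
  trans (cong₂ ℚ._+_ (ℚP.*-identityˡ (g zero)) (sum-zero (g ∘ suc))) (ℚP.+-identityʳ (g zero))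
sum-point-mass (suc i) g =
  trans (cong₂ ℚ._+_ (ℚP.*-zeroˡ (g zero)) (sum-point-mass i (g ∘ suc))) (ℚP.+-identityˡ (g (suc i)))

Between : ℕ → ℚ → Set
Between A q = 0ℚ ℚ.≤ q × q ℚ.≤ ιℕ A

affine : Point → ℤ → Pointℚ → ℚ
affine (a , b) e (x , y) = ι a ℚ.* x ℚ.+ ι b ℚ.* y ℚ.+ ι e

module Hull {n : ℕ} (P : Vec Point (suc n)) where
  open Width P

  px py : Fin (suc n) → ℚ
  px i = ι (proj₁ (lookup P i))
  py i = ι (proj₂ (lookup P i))

  affine-at-point : ∀ u e i → affine u e (px i , py i) ≡ ι (value u e i)
  affine-at-point (a , b) e i = sym (begin
    ι (a ℤ.* x ℤ.+ b ℤ.* y ℤ.+ e)          ≡⟨ ι-+ (a ℤ.* x ℤ.+ b ℤ.* y) e ⟩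
    ι (a ℤ.* x ℤ.+ b ℤ.* y) ℚ.+ ι e        ≡⟨ cong (ℚ._+ ι e) (ι-+ (a ℤ.* x) (b ℤ.* y)) ⟩
    ι (a ℤ.* x) ℚ.+ ι (b ℤ.* y) ℚ.+ ι e    ≡⟨ cong (ℚ._+ ι e) (cong₂ ℚ._+_ (ι-* a x) (ι-* b y)) ⟩
    ι a ℚ.* ι x ℚ.+ ι b ℚ.* ι y ℚ.+ ι e    ∎)
    where
    open ≡-Reasoning
    x y : ℤ
    x = proj₁ (lookup P i)
    y = proj₂ (lookup P i)

  affine-combination : ∀ u e (w : Fin (suc n) → ℚ) → sumFin w ≡ 1ℚ →
    affine u e (sumFin (λ i → w i ℚ.* px i) , sumFin (λ i → w i ℚ.* py i))
      ≡ sumFin (λ i → w i ℚ.* ι (value u e i))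
  affine-combination (a , b) e w Σw≡1 = begin
    ι a ℚ.* X ℚ.+ ι b ℚ.* Y ℚ.+ ι e
      ≡⟨ cong (λ s → ι a ℚ.* X ℚ.+ ι b ℚ.* Y ℚ.+ s) ιe≡ιe·Σw ⟩
    ι a ℚ.* X ℚ.+ ι b ℚ.* Y ℚ.+ ι e ℚ.* sumFin w
      ≡⟨ sum-affine w px py (ι a) (ι b) (ι e) ⟩
    sumFin (λ i → w i ℚ.* (ι a ℚ.* px i ℚ.+ ι b ℚ.* py i ℚ.+ ι e))
      ≡⟨ sum-cong _ _ (λ i → cong (w i ℚ.*_) (affine-at-point (a , b) e i)) ⟩
    sumFin (λ i → w i ℚ.* ι (value (a , b) e i))
      ∎
    where
    open ≡-Reasoning
    X Y : ℚ
    X = sumFin (λ i → w i ℚ.* px i)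
    Y = sumFin (λ i → w i ℚ.* py i)
    ιe≡ιe·Σw : ι e ≡ ι e ℚ.* sumFin w
    ιe≡ιe·Σw = sym (trans (cong (ι e ℚ.*_) Σw≡1) (ℚP.*-identityʳ (ι e)))

  range-on-hull : ∀ u e A → (∀ i → InRange A (value u e i)) → ∀ v → InConv P v → Between A (affine u e v)
  range-on-hull u e A inRange _ (w , w≥0 , Σw≡1 , refl , refl) =
    subst (Between A) (sym (affine-combination u e w Σw≡1))
      (convex-bounds w (λ i → ι (value u e i)) 0ℚ (ιℕ A) w≥0 Σw≡1
        (λ i → ι-mono (proj₁ (inRange i)) , ι-mono (proj₂ (inRange i))))

  point-in-hull : ∀ i → InConv P (px i , py i)
  point-in-hull i = point-mass i , point-mass-nonneg i , sum-one , sum-point-mass i px , sum-point-mass i py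
    where
    sum-one : sumFin (point-mass i) ≡ 1ℚ
    sum-one = trans (sum-cong _ _ (λ j → sym (ℚP.*-identityʳ (point-mass i j)))) (sum-point-mass i (λ _ → 1ℚ))

  range-at-points : ∀ u e A → (∀ v → InConv P v → Between A (affine u e v)) → ∀ i → InRange A (value u e i)
  range-at-points u e A onHull i with onHull _ (point-in-hull i)
  ... | lower , upper = ι-cancel (subst (0ℚ ℚ.≤_) (affine-at-point u e i) lower)
                      , ι-cancel (subst (ℚ._≤ ιℕ A) (affine-at-point u e i) upper)

module Placement {n : ℕ} (P : Vec Point (suc n)) where
  open Width P
  open Hull P

  row₁ row₂ : Unimodular → Point
  row₁ φ = Unimodular.a φ , Unimodular.b φ
  row₂ φ = Unimodular.c φ , Unimodular.d φ

  rows-basis : ∀ φ → Basis (row₁ φ) (row₂ φ)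
  rows-basis φ = Unimodular.det±1 φ

  strip-row : ∀ φ A → ImageIn φ P (Strip A) → ‖ row₁ φ ‖ ℕ.≤ A
  strip-row φ A inStrip = width-bound (row₁ φ) e A (range-at-points (row₁ φ) e A inStrip)
    where open Unimodular φ

  box-rows : ∀ φ A C → ImageIn φ P (Box A C) → ‖ row₁ φ ‖ ℕ.≤ A × ‖ row₂ φ ‖ ℕ.≤ C
  box-rows φ A C inBox =
      strip-row φ A (λ v v∈P → proj₁ (inBox v v∈P))
    , width-bound (row₂ φ) f C (range-at-points (row₂ φ) f C (λ v v∈P → proj₂ (inBox v v∈P)))
    where open Unimodular φ

  fit-box : ∀ u w A C → Basis u w → ‖ u ‖ ℕ.≤ A → ‖ w ‖ ℕ.≤ C → ∃ λ φ → ImageIn φ P (Box A C)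
  fit-box (a , b) (c , d) A C B u≤A w≤C = φ , λ v v∈P →
      range-on-hull (a , b) (M (neg (a , b))) A (centred-range (a , b) A u≤A) v v∈P
    , range-on-hull (c , d) (M (neg (c , d))) C (centred-range (c , d) C w≤C) v v∈P
    where
    φ : Unimodular
    φ = record { a = a ; b = b ; c = c ; d = d ; e = M (neg (a , b)) ; f = M (neg (c , d)) ; det±1 = B }

module Extremal {n : ℕ} (P : Vec Point (suc n)) {b₁ b₂ : Point}
                (B : Basis b₁ b₂) (R : Reduction.Reduced (Width.width P) b₁ b₂) where
  open Width P using (‖_‖; width)
  open Reduction width using (module Minima)
  open Minima B R
  open Placement P

  first-row : ∀ φ → ‖ b₁ ‖ ℕ.≤ ‖ row₁ φ ‖
  first-row φ = first-minimum (row₁ φ) (basis-nonzero (rows-basis φ))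

  rows : ∀ φ → ‖ b₂ ‖ ℕ.≤ ‖ row₁ φ ‖ ⊔ ‖ row₂ φ ‖
  rows φ = second-minimum-of-basis (row₁ φ) (row₂ φ) (rows-basis φ)

  in-S₁₁ : InS11 P (‖ b₁ ‖ , ‖ b₂ ‖)
  in-S₁₁ = proj₁ R , fit-box b₁ b₂ ‖ b₁ ‖ ‖ b₂ ‖ B ℕP.≤-refl ℕP.≤-refl

  least : ∀ m′ → InS11 P m′ → (‖ b₁ ‖ , ‖ b₂ ‖) ≤ₚ m′
  least (A , C) (A≤C , φ , inBox) =
    ℕP.≤-trans (first-row φ) r₁≤A , ℕP.≤-trans (rows φ) (ℕP.⊔-lub (ℕP.≤-trans r₁≤A A≤C) r₂≤C)
    where
    r₁≤A : ‖ row₁ φ ‖ ℕ.≤ A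
    r₁≤A = proj₁ (box-rows φ A C inBox)
    r₂≤C : ‖ row₂ φ ‖ ℕ.≤ C
    r₂≤C = proj₂ (box-rows φ A C inBox)

  lattice-width : IsLatticeWidth P ‖ b₁ ‖
  lattice-width = (proj₁ box , λ v v∈P → proj₁ (proj₂ box v v∈P))
                , λ { d (φ , inStrip) → ℕP.≤-trans (first-row φ) (strip-row φ d inStrip) }
    where
    box : ∃ λ φ → ImageIn φ P (Box ‖ b₁ ‖ ‖ b₂ ‖)
    box = proj₂ in-S₁₁

  lattice-size : IsLatticeSize P ‖ b₂ ‖
  lattice-size = fit-box b₁ b₂ ‖ b₂ ‖ ‖ b₂ ‖ B (proj₁ R) ℕP.≤-refl
               , λ { d (φ , inBox) → ℕP.≤-trans (rows φ) (uncurry ℕP.⊔-lub (box-rows φ d d inBox)) }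

theorem1 : ∀ (n : ℕ) (P : Vec Point (suc n)) →
    ∃ λ (m : ℕ × ℕ) →
      (InS11 P m × (∀ m' → InS11 P m' → m ≤ₚ m')) ×
      (IsLatticeWidth P (proj₁ m) × IsLatticeSize P (proj₂ m))
theorem1 n P =
  let open Width P using (‖_‖; width)
      b₁ , b₂ , B , R = Reduction.reduced-basis width
      open Extremal P B R
  in (‖ b₁ ‖ , ‖ b₂ ‖) , (in-S₁₁ , least) , (lattice-width , lattice-size)
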